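{- Let $a(0)<a(1)<a(2)<\cdots$ be the increasing enumeration (indexed from $0$) of the odious numbers, i.e. of the nonnegative integers whose sum of binary digits is odd (so $a = 1,2,4,7,8,11,13,14,\ldots$), and let $S(n)=a(0)+a(1)+\cdots+a(n)$. For integers $x,y$ write $x<_4 y$ (resp. $x\le_4 y$) if the residues $\overline{x},\overline{y}\in\{0,1,2,3\}$ of $x,y$ modulo $4$ satisfy $\overline{x}<\overline{y}$ (resp. $\overline{x}\le\overline{y}$), and define $>_4$, $\geq_4$ analogously. Then for every $n\ge 2$: (1) if $a(n-1)<_4 a(n+1)$ and $a(n)\le_4 a(n+2)$, then $S(n)=\frac{a(n)a(n+1)}{4}$; (2) if $a(n-1)>_4 a(n+1)$ and $a(n)\ge_4 a(n+2)$, then $S(n)=\frac{a(n)a(n+1)}{4}+\frac12$; (3) if $a(n-1)<_4 a(n+1)$ and $a(n)>_4 a(n+2)$, then $S(n)=\frac{a(n)(a(n+1)-1)}{4}$; (4) if $a(n-1)>_4 a(n+1)$ and $a(n)<_4 a(n+2)$, then $S(n)=\frac{(a(n)+1)a(n+1)}{4}$.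
   Context: The natural numbers include $0$. "Increasing" means strictly increasing. -}

module Defs where

open import Data.Nat using (ℕ; zero; suc; _+_; _*_; _<_; _%_; _/_)
open import Relation.Binary.PropositionalEquality using (_≡_)

-- sum of binary digits, computed with fuel; fuel n suffices for n
-- (n has at most n binary digits), so binSum n is the true digit sum.
binSumFuel : ℕ → ℕ → ℕ
binSumFuel zero    _ = 0
binSumFuel (suc f) n = n % 2 + binSumFuel f (n / 2)

binSum : ℕ → ℕ
binSum n = binSumFuel n n

Odious : ℕ → Set
Odious n = binSum n % 2 ≡ 1

S : (ℕ → ℕ) → ℕ → ℕ
S a zero    = a zero
S a (suc n) = S a n + a (suc n)

_<₄_ : ℕ → ℕ → Set
x <₄ y = x % 4 < y % 4

_≤₄_ : ℕ → ℕ → Set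
x ≤₄ y = x % 4 Data.Nat.≤ y % 4

_>₄_ : ℕ → ℕ → Set
x >₄ y = y <₄ x

_≥₄_ : ℕ → ℕ → Set
x ≥₄ y = y ≤₄ x

-- Every block 4k, …, 4k + 3 contains exactly two odious numbers, since its
-- last two binary digits add 0, 1, 1, 2 to the digit sum of k: they are 4k + 1,
-- 4k + 2 if k is evil and 4k, 4k + 3 if k is odious.  As strictly increasing
-- enumerations of the same set coincide, a(2k) and a(2k + 1) are these two
-- numbers; they add up to 8k + 3, so 4 S(2k + 1) = (4k + 4)(4k + 3).  The
-- residues of a(n - 1), …, a(n + 2) mod 4 are thus fixed by the digit parities
-- of three consecutive block indices, and in each configuration the case whose
-- hypotheses hold, if any, reduces to a polynomial identity in k.

module Submission where

open import Defs
open import Data.Nat using (ℕ; zero; suc; _+_; _*_; _∸_; _<_; _≤_; _≤′_; ≤′-refl; ≤′-step; _%_; _/_; z≤n; s≤s; z<s; NonZero)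
open import Data.Nat.Properties
open import Data.Nat.DivMod
open import Data.Nat.Tactic.RingSolver using (solve-∀)
open import Data.Product using (_×_; _,_; ∃)
open import Data.Sum using (_⊎_; inj₁; inj₂)
open import Data.Empty using (⊥-elim)
open import Function.Bundles using (_⇔_; mk⇔; Equivalence)
open import Relation.Binary.Core using (_Preserves_⟶_)
open import Relation.Binary.PropositionalEquality

[m+kn]/n≡k : ∀ m k n .{{_ : NonZero n}} → m < n → (m + k * n) / n ≡ k
[m+kn]/n≡k m k n m<n = begin
  (m + k * n) / n     ≡⟨ +-distrib-/ m (k * n) digits<n ⟩
  m / n + k * n / n   ≡⟨ cong₂ _+_ (m<n⇒m/n≡0 m<n) (m*n/n≡m k n) ⟩
  k                   ∎
  where
  open ≡-Reasoning
  digits≡m : m % n + k * n % n ≡ m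
  digits≡m = trans (cong₂ _+_ (m<n⇒m%n≡m m<n) (m*n%n≡0 k n)) (+-identityʳ m)
  digits<n : m % n + k * n % n < n
  digits<n = subst (_< n) (sym digits≡m) m<n

m%n≡ρ⇒ρ+[m/n]*n≡m : ∀ {m n ρ} .{{_ : NonZero n}} → m % n ≡ ρ → ρ + m / n * n ≡ m
m%n≡ρ⇒ρ+[m/n]*n≡m {m} {n} refl = sym (m≡m%n+[m/n]*n m n)

even-or-odd : ∀ n → ∃ λ k → n ≡ k * 2 ⊎ n ≡ 1 + k * 2
even-or-odd zero = 0 , inj₁ refl
even-or-odd (suc n) with even-or-odd n
... | k , inj₁ refl = k , inj₂ refl
... | k , inj₂ refl = suc k , inj₁ refl

<-suc⇒increasing : ∀ {f : ℕ → ℕ} → (∀ n → f n < f (suc n)) → f Preserves _<_ ⟶ _<_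
<-suc⇒increasing step {m} {suc n} m<1+n with m≤n⇒m<n∨m≡n (≤-pred m<1+n)
... | inj₁ m<n  = <-trans (<-suc⇒increasing step m<n) (step n)
... | inj₂ refl = step n

module _ {f : ℕ → ℕ} (f-inc : f Preserves _<_ ⟶ _<_) where

  increasing⇒monotone : f Preserves _≤_ ⟶ _≤_
  increasing⇒monotone m≤n with m≤n⇒m<n∨m≡n m≤n
  ... | inj₁ m<n  = <⇒≤ (f-inc m<n)
  ... | inj₂ refl = ≤-refl

  increasing⇒reflects-< : ∀ {m n} → f m < f n → m < n
  increasing⇒reflects-< fm<fn = ≰⇒> (λ n≤m → <⇒≱ fm<fn (increasing⇒monotone n≤m))

module _ {f g : ℕ → ℕ} (f-inc : f Preserves _<_ ⟶ _<_) (g-inc : g Preserves _<_ ⟶ _<_)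
         (g⊆f : ∀ n → ∃ λ m → f m ≡ g n) where

  enumeration-index-≥ : ∀ n {m} → f m ≡ g n → n ≤ m
  enumeration-index-≥ zero    _       = z≤n
  enumeration-index-≥ (suc n) fm≡g1+n with g⊆f n
  ... | m′ , fm′≡gn = ≤-<-trans (enumeration-index-≥ n fm′≡gn)
    (increasing⇒reflects-< f-inc (subst₂ _<_ (sym fm′≡gn) (sym fm≡g1+n) (g-inc (n<1+n n))))

  image⊆⇒≤ : ∀ n → f n ≤ g n
  image⊆⇒≤ n with g⊆f n
  ... | m , fm≡gn = subst (f n ≤_) fm≡gn (increasing⇒monotone f-inc (enumeration-index-≥ n fm≡gn))

increasing-same-image⇒≗ : ∀ {f g : ℕ → ℕ} → f Preserves _<_ ⟶ _<_ → g Preserves _<_ ⟶ _<_ →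
  (∀ n → ∃ λ m → f m ≡ g n) → (∀ n → ∃ λ m → g m ≡ f n) → f ≗ g
increasing-same-image⇒≗ f-inc g-inc g⊆f f⊆g n =
  ≤-antisym (image⊆⇒≤ f-inc g-inc g⊆f n) (image⊆⇒≤ g-inc f-inc f⊆g n)

binSumFuel-suc : ∀ {f n} → n ≤ f → binSumFuel (suc f) n ≡ binSumFuel f n
binSumFuel-suc {zero}  z≤n = refl
binSumFuel-suc {suc f} {n} n≤1+f = cong (n % 2 +_) (binSumFuel-suc (half≤f n n≤1+f))
  where
  half≤f : ∀ n → n ≤ suc f → n / 2 ≤ f
  half≤f zero    _  = z≤n
  half≤f (suc n) le = ≤-pred (≤-trans (m/n<m (suc n) 2 ≤-refl) le)

binSumFuel-adequate : ∀ {f n} → n ≤′ f → binSumFuel f n ≡ binSum n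
binSumFuel-adequate ≤′-refl = refl
binSumFuel-adequate (≤′-step n≤′f) = trans (binSumFuel-suc (≤′⇒≤ n≤′f)) (binSumFuel-adequate n≤′f)

binSum-unfold : ∀ n → binSum n ≡ n % 2 + binSum (n / 2)
binSum-unfold zero    = refl
binSum-unfold (suc n) = cong (suc n % 2 +_) (binSumFuel-adequate (≤⇒≤′ (≤-pred (m/n<m (suc n) 2 ≤-refl))))

binSum[b+m*2]≡b+binSum[m] : ∀ b m → b < 2 → binSum (b + m * 2) ≡ b + binSum m
binSum[b+m*2]≡b+binSum[m] b m b<2 = begin
  binSum (b + m * 2)                           ≡⟨ binSum-unfold (b + m * 2) ⟩
  (b + m * 2) % 2 + binSum ((b + m * 2) / 2)   ≡⟨ cong₂ _+_ (trans ([m+kn]%n≡m%n b m 2) (m<n⇒m%n≡m b<2))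
                                                            (cong binSum ([m+kn]/n≡k b m 2 b<2)) ⟩
  b + binSum m                                 ∎
  where open ≡-Reasoning

binSum[b₀+b₁*2+k*4]≡b₀+b₁+binSum[k] : ∀ b₀ b₁ k → b₀ < 2 → b₁ < 2 →
  binSum (b₀ + b₁ * 2 + k * 4) ≡ b₀ + b₁ + binSum k
binSum[b₀+b₁*2+k*4]≡b₀+b₁+binSum[k] b₀ b₁ k b₀<2 b₁<2 = begin
  binSum (b₀ + b₁ * 2 + k * 4)    ≡⟨ cong binSum (regroup b₀ b₁ k) ⟩
  binSum (b₀ + (b₁ + k * 2) * 2)  ≡⟨ binSum[b+m*2]≡b+binSum[m] b₀ (b₁ + k * 2) b₀<2 ⟩
  b₀ + binSum (b₁ + k * 2)        ≡⟨ cong (b₀ +_) (binSum[b+m*2]≡b+binSum[m] b₁ k b₁<2) ⟩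
  b₀ + (b₁ + binSum k)            ≡⟨ sym (+-assoc b₀ b₁ (binSum k)) ⟩
  b₀ + b₁ + binSum k              ∎
  where
  open ≡-Reasoning
  regroup : ∀ b₀ b₁ k → b₀ + b₁ * 2 + k * 4 ≡ b₀ + (b₁ + k * 2) * 2
  regroup = solve-∀

binSum[ρ+k*4]≡binSum[ρ]+binSum[k] : ∀ ρ k → ρ < 4 → binSum (ρ + k * 4) ≡ binSum ρ + binSum k
binSum[ρ+k*4]≡binSum[ρ]+binSum[k] 0 k _ = binSum[b₀+b₁*2+k*4]≡b₀+b₁+binSum[k] 0 0 k z<s z<s
binSum[ρ+k*4]≡binSum[ρ]+binSum[k] 1 k _ = binSum[b₀+b₁*2+k*4]≡b₀+b₁+binSum[k] 1 0 k ≤-refl z<s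
binSum[ρ+k*4]≡binSum[ρ]+binSum[k] 2 k _ = binSum[b₀+b₁*2+k*4]≡b₀+b₁+binSum[k] 0 1 k z<s ≤-refl
binSum[ρ+k*4]≡binSum[ρ]+binSum[k] 3 k _ = binSum[b₀+b₁*2+k*4]≡b₀+b₁+binSum[k] 1 1 k ≤-refl ≤-refl
binSum[ρ+k*4]≡binSum[ρ]+binSum[k] (suc (suc (suc (suc _)))) _ (s≤s (s≤s (s≤s (s≤s ()))))

digitParity : ℕ → ℕ
digitParity n = binSum n % 2

binSum[ρ+k*4]%2 : ∀ ρ k → ρ < 4 → binSum (ρ + k * 4) % 2 ≡ (binSum ρ % 2 + digitParity k) % 2
binSum[ρ+k*4]%2 ρ k ρ<4 =
  trans (cong (_% 2) (binSum[ρ+k*4]≡binSum[ρ]+binSum[k] ρ k ρ<4)) (%-distribˡ-+ (binSum ρ) (binSum k) 2)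

-- If k has digit parity p, the odious numbers among 4k, …, 4k + 3 are
-- 4k + lowOffset p and 4k + highOffset p.
lowOffset highOffset : ℕ → ℕ
lowOffset zero     = 1
lowOffset (suc _)  = 0
highOffset zero    = 2
highOffset (suc _) = 3

lowOffset+highOffset≡3 : ∀ p → lowOffset p + highOffset p ≡ 3
lowOffset+highOffset≡3 zero    = refl
lowOffset+highOffset≡3 (suc _) = refl

lowOffset<highOffset : ∀ p → lowOffset p < highOffset p
lowOffset<highOffset zero    = s≤s z<s
lowOffset<highOffset (suc _) = z<s

lowOffset≤1 : ∀ p → lowOffset p ≤ 1
lowOffset≤1 zero    = ≤-refl
lowOffset≤1 (suc _) = z≤n

highOffset<4 : ∀ p → highOffset p < 4
highOffset<4 zero    = s≤s (s≤s z<s)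
highOffset<4 (suc _) = ≤-refl

lowOffset<4 : ∀ p → lowOffset p < 4
lowOffset<4 p = <-trans (lowOffset<highOffset p) (highOffset<4 p)

highOffset+x<lowOffset+[4+x] : ∀ p q x → highOffset p + x < lowOffset q + (4 + x)
highOffset+x<lowOffset+[4+x] p q x = <-≤-trans (+-monoˡ-< x (highOffset<4 p)) (m≤n+m (4 + x) (lowOffset q))

Odious[ρ+k*4]⇔offset : ∀ ρ k → ρ < 4 →
  Odious (ρ + k * 4) ⇔ (ρ ≡ lowOffset (digitParity k) ⊎ ρ ≡ highOffset (digitParity k))
Odious[ρ+k*4]⇔offset ρ k ρ<4 = mk⇔
  (λ odious-ρ → to ρ _ ρ<4 p<2 (trans (sym (binSum[ρ+k*4]%2 ρ k ρ<4)) odious-ρ))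
  (λ offset → trans (binSum[ρ+k*4]%2 ρ k ρ<4) (from _ p<2 offset))
  where
  p<2 : digitParity k < 2
  p<2 = m%n<n (binSum k) 2
  to : ∀ ρ p → ρ < 4 → p < 2 → (binSum ρ % 2 + p) % 2 ≡ 1 → ρ ≡ lowOffset p ⊎ ρ ≡ highOffset p
  to 0 0 _ _ ()
  to 0 1 _ _ _ = inj₁ refl
  to 1 0 _ _ _ = inj₁ refl
  to 1 1 _ _ ()
  to 2 0 _ _ _ = inj₂ refl
  to 2 1 _ _ ()
  to 3 0 _ _ ()
  to 3 1 _ _ _ = inj₂ refl
  to (suc (suc (suc (suc _)))) _ (s≤s (s≤s (s≤s (s≤s ())))) _ _
  to _ (suc (suc _)) _ (s≤s (s≤s ())) _
  from : ∀ {ρ} p → p < 2 → ρ ≡ lowOffset p ⊎ ρ ≡ highOffset p → (binSum ρ % 2 + p) % 2 ≡ 1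
  from 0 _ (inj₁ refl) = refl
  from 0 _ (inj₂ refl) = refl
  from 1 _ (inj₁ refl) = refl
  from 1 _ (inj₂ refl) = refl
  from (suc (suc _)) (s≤s (s≤s ())) _

blockMember : ℕ → ℕ → ℕ
blockMember zero    k = lowOffset (digitParity k) + k * 4
blockMember (suc _) k = highOffset (digitParity k) + k * 4

odious : ℕ → ℕ
odious n = blockMember (n % 2) (n / 2)

odious-even : ∀ k → odious (k * 2) ≡ lowOffset (digitParity k) + k * 4
odious-even k = cong₂ blockMember (m*n%n≡0 k 2) (m*n/n≡m k 2)

odious-odd : ∀ k → odious (1 + k * 2) ≡ highOffset (digitParity k) + k * 4
odious-odd k = cong₂ blockMember ([m+kn]%n≡m%n 1 k 2) ([m+kn]/n≡k 1 k 2 ≤-refl)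

odious-Odious : ∀ n → Odious (odious n)
odious-Odious n with even-or-odd n
... | k , inj₁ refl = subst Odious (sym (odious-even k))
  (Equivalence.from (Odious[ρ+k*4]⇔offset _ k (lowOffset<4 (digitParity k))) (inj₁ refl))
... | k , inj₂ refl = subst Odious (sym (odious-odd k))
  (Equivalence.from (Odious[ρ+k*4]⇔offset _ k (highOffset<4 (digitParity k))) (inj₂ refl))

odious-complete : ∀ m → Odious m → ∃ λ n → odious n ≡ m
odious-complete m odious-m with Equivalence.to (Odious[ρ+k*4]⇔offset (m % 4) (m / 4) (m%n<n m 4))
                                  (subst Odious (m≡m%n+[m/n]*n m 4) odious-m)
... | inj₁ ρ≡low  = m / 4 * 2     , trans (odious-even (m / 4)) (m%n≡ρ⇒ρ+[m/n]*n≡m ρ≡low)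
... | inj₂ ρ≡high = 1 + m / 4 * 2 , trans (odious-odd (m / 4))  (m%n≡ρ⇒ρ+[m/n]*n≡m ρ≡high)

odious-<-suc : ∀ n → odious n < odious (suc n)
odious-<-suc n with even-or-odd n
... | k , inj₁ refl = subst₂ _<_ (sym (odious-even k)) (sym (odious-odd k))
  (+-monoˡ-< (k * 4) (lowOffset<highOffset (digitParity k)))
... | k , inj₂ refl = subst₂ _<_ (sym (odious-odd k)) (sym (odious-even (suc k)))
  (highOffset+x<lowOffset+[4+x] (digitParity k) (digitParity (suc k)) (k * 4))

S-cong : ∀ {f g : ℕ → ℕ} → f ≗ g → ∀ n → S f n ≡ S g n
S-cong f≗g zero    = f≗g zero
S-cong f≗g (suc n) = cong₂ _+_ (S-cong f≗g n) (f≗g (suc n))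

odious-pair-sum : ∀ k → odious (k * 2) + odious (1 + k * 2) ≡ 3 + k * 8
odious-pair-sum k = begin
  odious (k * 2) + odious (1 + k * 2)             ≡⟨ cong₂ _+_ (odious-even k) (odious-odd k) ⟩
  lowOffset p + k * 4 + (highOffset p + k * 4)    ≡⟨ regroup (lowOffset p) (highOffset p) k ⟩
  lowOffset p + highOffset p + k * 8              ≡⟨ cong (_+ k * 8) (lowOffset+highOffset≡3 p) ⟩
  3 + k * 8                                       ∎
  where
  open ≡-Reasoning
  p = digitParity k
  regroup : ∀ l h k → l + k * 4 + (h + k * 4) ≡ l + h + k * 8
  regroup = solve-∀

S-odious-odd : ∀ k → 4 * S odious (1 + k * 2) ≡ (4 + k * 4) * (3 + k * 4)
S-odious-odd zero    = refl
S-odious-odd (suc k) = begin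
  4 * (S odious (1 + k * 2) + odious (suc k * 2) + odious (1 + suc k * 2))
    ≡⟨ distrib (S odious (1 + k * 2)) (odious (suc k * 2)) (odious (1 + suc k * 2)) ⟩
  4 * S odious (1 + k * 2) + 4 * (odious (suc k * 2) + odious (1 + suc k * 2))
    ≡⟨ cong₂ _+_ (S-odious-odd k) (cong (4 *_) (odious-pair-sum (suc k))) ⟩
  (4 + k * 4) * (3 + k * 4) + 4 * (3 + (1 + k) * 8)
    ≡⟨ next-block k ⟩
  (4 + (1 + k) * 4) * (3 + (1 + k) * 4)
    ∎
  where
  open ≡-Reasoning
  distrib : ∀ s u v → 4 * (s + u + v) ≡ 4 * s + 4 * (u + v)
  distrib = solve-∀
  next-block : ∀ k → (4 + k * 4) * (3 + k * 4) + 4 * (3 + (1 + k) * 8) ≡ (4 + (1 + k) * 4) * (3 + (1 + k) * 4)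
  next-block = solve-∀

S-odious-even : ∀ k →
  4 * S odious (suc k * 2) ≡ (4 + k * 4) * (3 + k * 4) + 4 * (lowOffset (digitParity (suc k)) + suc k * 4)
S-odious-even k = trans (*-distribˡ-+ 4 (S odious (1 + k * 2)) (odious (suc k * 2)))
                        (cong₂ _+_ (S-odious-odd k) (cong (4 *_) (odious-even (suc k))))

Cases : (ρp ρq ρr ρt q r s : ℕ) → Set
Cases ρp ρq ρr ρt q r s =
    (ρp < ρr → ρq ≤ ρt → s ≡ q * r)
  × (ρr < ρp → ρt ≤ ρq → s ≡ q * r + 2)
  × (ρp < ρr → ρt < ρq → s ≡ q * (r ∸ 1))
  × (ρr < ρp → ρq < ρt → s ≡ (q + 1) * r)

Conclusion : (ℕ → ℕ) → ℕ → Set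
Conclusion f n = Cases (f (n ∸ 1) % 4) (f n % 4) (f (suc n) % 4) (f (suc (suc n)) % 4) (f n) (f (suc n)) (4 * S f n)

Cases-cong : ∀ {ρp ρq ρr ρt q r s ρp′ ρq′ ρr′ ρt′ q′ r′ s′} →
  ρp ≡ ρp′ → ρq ≡ ρq′ → ρr ≡ ρr′ → ρt ≡ ρt′ → q ≡ q′ → r ≡ r′ → s ≡ s′ →
  Cases ρp′ ρq′ ρr′ ρt′ q′ r′ s′ → Cases ρp ρq ρr ρt q r s
Cases-cong refl refl refl refl refl refl refl cases = cases

Conclusion-cong : ∀ {f g : ℕ → ℕ} → f ≗ g → ∀ n → Conclusion g n → Conclusion f n
Conclusion-cong f≗g n = Cases-cong (cong (_% 4) (f≗g (n ∸ 1))) (cong (_% 4) (f≗g n))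
  (cong (_% 4) (f≗g (suc n))) (cong (_% 4) (f≗g (suc (suc n)))) (f≗g n) (f≗g (suc n)) (cong (4 *_) (S-cong f≗g n))

vacuous : ∀ {ρ} {B A : Set} → ρ < ρ → B → A
vacuous ρ<ρ _ = ⊥-elim (<-irrefl refl ρ<ρ)

-- b, c and the d behind ρt = lowOffset d are the digit parities of the blocks
-- k, k + 1, k + 2 met by a(n - 1), …, a(n + 2), and x = 4k.
odd-index-cases : ∀ b c x →
  Cases (lowOffset b) (highOffset b) (lowOffset c) (highOffset c)
        (highOffset b + x) (lowOffset c + (4 + x)) ((4 + x) * (3 + x))
odd-index-cases zero    zero    x = vacuous , vacuous , vacuous , vacuous
odd-index-cases (suc _) (suc _) x = vacuous , vacuous , vacuous , vacuous
odd-index-cases zero    (suc _) x = (λ ()) , (λ { _ (s≤s (s≤s ())) }) , (λ ()) , λ _ _ → identity x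
  where
  identity : ∀ x → (4 + x) * (3 + x) ≡ (2 + x + 1) * (0 + (4 + x))
  identity = solve-∀
odd-index-cases (suc _) zero    x = (λ { _ (s≤s (s≤s ())) }) , (λ ()) , (λ _ _ → *-comm (4 + x) (3 + x)) , (λ ())

even-index-cases : ∀ b c ρt x → ρt ≤ 1 →
  Cases (highOffset b) (lowOffset c) (highOffset c) ρt
        (lowOffset c + (4 + x)) (highOffset c + (4 + x)) ((4 + x) * (3 + x) + 4 * (lowOffset c + (4 + x)))
even-index-cases zero    zero    ρt x _ = vacuous , vacuous , vacuous , vacuous
even-index-cases (suc _) (suc _) ρt x _ = vacuous , vacuous , vacuous , vacuous
even-index-cases zero    (suc _) ρt x _ =
  (λ _ _ → identity x) , (λ { (s≤s (s≤s ())) _ }) , (λ _ ()) , (λ { (s≤s (s≤s ())) _ })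
  where
  identity : ∀ x → (4 + x) * (3 + x) + 4 * (0 + (4 + x)) ≡ (0 + (4 + x)) * (3 + (4 + x))
  identity = solve-∀
even-index-cases (suc _) zero    ρt x ρt≤1 =
    (λ { (s≤s (s≤s ())) _ }) , (λ _ _ → identity x)
  , (λ { (s≤s (s≤s ())) _ }) , (λ _ 1<ρt → ⊥-elim (<⇒≱ 1<ρt ρt≤1))
  where
  identity : ∀ x → (4 + x) * (3 + x) + 4 * (1 + (4 + x)) ≡ (1 + (4 + x)) * (2 + (4 + x)) + 2
  identity = solve-∀

[ρ+k*4]%4≡ρ : ∀ ρ k → ρ < 4 → (ρ + k * 4) % 4 ≡ ρ
[ρ+k*4]%4≡ρ ρ k ρ<4 = trans ([m+kn]%n≡m%n ρ k 4) (m<n⇒m%n≡m ρ<4)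

odious-even-%4 : ∀ k → odious (k * 2) % 4 ≡ lowOffset (digitParity k)
odious-even-%4 k = trans (cong (_% 4) (odious-even k)) ([ρ+k*4]%4≡ρ _ k (lowOffset<4 (digitParity k)))

odious-odd-%4 : ∀ k → odious (1 + k * 2) % 4 ≡ highOffset (digitParity k)
odious-odd-%4 k = trans (cong (_% 4) (odious-odd k)) ([ρ+k*4]%4≡ρ _ k (highOffset<4 (digitParity k)))

odious-conclusion-odd : ∀ k → Conclusion odious (1 + k * 2)
odious-conclusion-odd k =
  Cases-cong (odious-even-%4 k) (odious-odd-%4 k) (odious-even-%4 (suc k)) (odious-odd-%4 (suc k))
             (odious-odd k) (odious-even (suc k)) (S-odious-odd k)
             (odd-index-cases (digitParity k) (digitParity (suc k)) (k * 4))

odious-conclusion-even : ∀ k → Conclusion odious (suc k * 2)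
odious-conclusion-even k =
  Cases-cong (odious-odd-%4 k) (odious-even-%4 (suc k)) (odious-odd-%4 (suc k)) (odious-even-%4 (suc (suc k)))
             (odious-even (suc k)) (odious-odd (suc k)) (S-odious-even k)
             (even-index-cases (digitParity k) (digitParity (suc k)) _ (k * 4) (lowOffset≤1 (digitParity (suc (suc k)))))

odious-conclusion : ∀ n → 2 ≤ n → Conclusion odious n
odious-conclusion n 2≤n with even-or-odd n
odious-conclusion .0 () | zero , inj₁ refl
... | suc k , inj₁ refl = odious-conclusion-even k
... | k     , inj₂ refl = odious-conclusion-odd k

theorem4p4 : (a : ℕ → ℕ)
    → (∀ m n → m < n → a m < a n)
    → (∀ n → Odious (a n))
    → (∀ m → Odious m → ∃ λ n → a n ≡ m)
    → ∀ n → 2 ≤ n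
    → ((a (n ∸ 1) <₄ a (n + 1) → a n ≤₄ a (n + 2) → 4 * S a n ≡ a n * a (n + 1))
      × (a (n ∸ 1) >₄ a (n + 1) → a n ≥₄ a (n + 2) → 4 * S a n ≡ a n * a (n + 1) + 2)
      × (a (n ∸ 1) <₄ a (n + 1) → a n >₄ a (n + 2) → 4 * S a n ≡ a n * (a (n + 1) ∸ 1))
      × (a (n ∸ 1) >₄ a (n + 1) → a n <₄ a (n + 2) → 4 * S a n ≡ (a n + 1) * a (n + 1)))
theorem4p4 a inc odious-a complete n 2≤n rewrite +-comm n 1 | +-comm n 2 =
  Conclusion-cong a≗odious n (odious-conclusion n 2≤n)
  where
  a≗odious : a ≗ odious
  a≗odious = increasing-same-image⇒≗ (inc _ _) (<-suc⇒increasing odious-<-suc)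
    (λ n → complete (odious n) (odious-Odious n)) (λ n → odious-complete (a n) (odious-a n))
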